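{- Let $P$ be a $*$-term and $Q$ a $P^d$-term (so that $P \wedge^{\bullet} Q$ is a $*$-term). Then $\mathrm{fe}(P \wedge^{\bullet} Q)$ has the unique conjunction decomposition $(\mathrm{fe}(P)[\mathsf{T}\mapsto\Box_1, \mathsf{F}\mapsto\Box_2], \mathrm{fe}(Q))$ and no disjunction decomposition. Let $P$ be a $*$-term and $Q$ a $P^c$-term (so that $P \vee^{\bullet} Q$ is a $*$-term). Then $\mathrm{fe}(P \vee^{\bullet} Q)$ has no conjunction decomposition and its unique disjunction decomposition is $(\mathrm{fe}(P)[\mathsf{T}\mapsto\Box_1, \mathsf{F}\mapsto\Box_2], \mathrm{fe}(Q))$.
   Context: Let $A$ be a countable set of atoms. FEL-terms: $P ::= a \ (a\in A) \mid \mathsf{T} \mid \mathsf{F} \mid \neg P \mid (P \wedge^{\bullet} P) \mid (P \vee^{\bullet} P)$. Subgrammars (with $a \in A$): $\mathsf{T}$-terms $P^{\mathsf{T}} ::= \mathsf{T} \mid a \vee^{\bullet} P^{\mathsf{T}}$; $\ell$-terms $P^{\ell} ::= a \wedge^{\bullet} P^{\mathsf{T}} \mid \neg a \wedge^{\bullet} P^{\mathsf{T}}$; $*$-terms $P^* ::= P^c \mid P^d$, with $P^c ::= P^{\ell} \mid P^* \wedge^{\bullet} P^d$ and $P^d ::= P^{\ell} \mid P^* \vee^{\bullet} P^c$. $\mathcal{T}$ is the set of finite binary trees with leaves in $\{\mathsf{T},\mathsf{F}\}$: $\mathsf{T}, \mathsf{F}\in\mathcal{T}$, $(X \trianglelefteq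 a \trianglerighteq Y)\in\mathcal{T}$ for $X,Y\in\mathcal{T}$, $a\in A$ (root $a$, left branch $X$, right branch $Y$); $\mathcal{T}_{1,2}$ is the analogous set of trees with leaves in $\{\mathsf{T},\mathsf{F},\Box_1,\Box_2\}$. Leaf replacement $X[\ell_1\mapsto Y_1, \ell_2\mapsto Y_2]$ replaces every leaf $\ell_i$ of $X$ by $Y_i$ (recursively through $\trianglelefteq a \trianglerighteq$), other leaves unchanged. Depth: $d(\text{leaf}) = 0$, $d(Y \trianglelefteq a \trianglerighteq Z) = 1 + \max(d(Y), d(Z))$. $\mathrm{fe}$: $\mathrm{fe}(\mathsf{T}) = \mathsf{T}$, $\mathrm{fe}(\mathsf{F}) = \mathsf{F}$, $\mathrm{fe}(a) = \mathsf{T} \trianglelefteq a \trianglerighteq \mathsf{F}$, $\mathrm{fe}(\neg P) = \mathrm{fe}(P)[\mathsf{T}\mapsto\mathsf{F}, \mathsf{F}\mapsto\mathsf{T}]$, $\mathrm{fe}(P \wedge^{\bullet} Q) = \mathrm{fe}(P)[\mathsf{T}\mapsto \mathrm{fe}(Q), \mathsf{F}\mapsto \mathrm{fe}(Q)[\mathsf{T}\mapsto\mathsf{F}]]$, $\mathrm{fe}(P \vee^{\bullet} Q) = \mathrm{fe}(P)[\mathsf{T}\mapsto \mathrm{fe}(Q)[\mathsf{F}\mapsto\mathsf{T}], \mathsf{F}\mapsto \mathrm{fe}(Q)]$. For $X\in\mathcal{T}$, a pair $(Y,Z)\in\mathcal{T}_{1,2}\times\mathcal{T}$ is a candidate conjunction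 decomposition (ccd) of $X$ if $X = Y[\Box_1\mapsto Z, \Box_2\mapsto Z[\mathsf{T}\mapsto\mathsf{F}]]$, $Y$ contains both $\Box_1$ and $\Box_2$, $Y$ contains neither $\mathsf{T}$ nor $\mathsf{F}$, and $Z$ contains both $\mathsf{T}$ and $\mathsf{F}$; it is a candidate disjunction decomposition (cdd) if the same holds with the first condition replaced by $X = Y[\Box_1\mapsto Z[\mathsf{F}\mapsto\mathsf{T}], \Box_2\mapsto Z]$. A conjunction decomposition (cd) of $X$ is a ccd $(Y,Z)$ such that no other ccd $(Y',Z')$ of $X$ has $d(Z') < d(Z)$; a disjunction decomposition (dd) is defined likewise from cdds. -}

module Defs where

open import Data.Nat using (ℕ; _<_; _⊔_; suc)
open import Data.Product using (_×_; Σ; _,_)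
open import Relation.Nullary using (¬_)
open import Relation.Binary.PropositionalEquality using (_≡_)

-- Atoms: the countable set A is represented by ℕ.
Atom : Set
Atom = ℕ

data FEL : Set where
  atom : Atom → FEL
  TT   : FEL
  FF   : FEL
  ¬ᶠ_  : FEL → FEL
  _∧●_ : FEL → FEL → FEL
  _∨●_ : FEL → FEL → FEL

data TTerm : FEL → Set where
  tT  : TTerm TT
  tOr : ∀ a {P} → TTerm P → TTerm (atom a ∨● P)

data LTerm : FEL → Set where
  lPos : ∀ a {P} → TTerm P → LTerm (atom a ∧● P)
  lNeg : ∀ a {P} → TTerm P → LTerm ((¬ᶠ atom a) ∧● P)

data StarTerm : FEL → Set
data CTerm : FEL → Set
data DTerm : FEL → Set

data StarTerm where
  sC : ∀ {P} → CTerm P → StarTerm P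
  sD : ∀ {P} → DTerm P → StarTerm P

data CTerm where
  cL   : ∀ {P} → LTerm P → CTerm P
  cAnd : ∀ {P Q} → StarTerm P → DTerm Q → CTerm (P ∧● Q)

data DTerm where
  dL  : ∀ {P} → LTerm P → DTerm P
  dOr : ∀ {P Q} → StarTerm P → CTerm Q → DTerm (P ∨● Q)

-- Leaves: T, F, □₁, □₂.  Trees over all four leaves form 𝒯₁,₂;
-- 𝒯 is the subset of trees without □-leaves (predicate NoBox).
data Leaf : Set where
  T F □₁ □₂ : Leaf

data Tree : Set where
  leaf : Leaf → Tree
  _⊴_⊵_ : Tree → Atom → Tree → Tree

data Contains (l : Leaf) : Tree → Set where
  here  : Contains l (leaf l)
  left  : ∀ {X a Y} → Contains l X → Contains l (X ⊴ a ⊵ Y)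
  right : ∀ {X a Y} → Contains l Y → Contains l (X ⊴ a ⊵ Y)

NoBox : Tree → Set
NoBox X = ¬ Contains □₁ X × ¬ Contains □₂ X

replace : (Leaf → Tree) → Tree → Tree
replace σ (leaf l) = σ l
replace σ (X ⊴ a ⊵ Y) = replace σ X ⊴ a ⊵ replace σ Y

open import Data.Bool using (Bool; true; false; if_then_else_)

eqL : Leaf → Leaf → Bool
eqL T T = true
eqL F F = true
eqL □₁ □₁ = true
eqL □₂ □₂ = true
eqL _ _ = false

_[_↦_,_↦_] : Tree → Leaf → Tree → Leaf → Tree → Tree
X [ l₁ ↦ Y₁ , l₂ ↦ Y₂ ] =
  replace (λ l → if eqL l l₁ then Y₁ else (if eqL l l₂ then Y₂ else leaf l)) X

_[_↦_] : Tree → Leaf → Tree → Tree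
X [ l ↦ Y ] = replace (λ l' → if eqL l' l then Y else leaf l') X

depth : Tree → ℕ
depth (leaf _) = 0
depth (X ⊴ _ ⊵ Y) = suc (depth X ⊔ depth Y)

fe : FEL → Tree
fe (atom a) = leaf T ⊴ a ⊵ leaf F
fe TT = leaf T
fe FF = leaf F
fe (¬ᶠ P) = fe P [ T ↦ leaf F , F ↦ leaf T ]
fe (P ∧● Q) = fe P [ T ↦ fe Q , F ↦ fe Q [ T ↦ leaf F ] ]
fe (P ∨● Q) = fe P [ T ↦ fe Q [ F ↦ leaf T ] , F ↦ fe Q ]

DecompShape : Tree → Tree → Tree → Set
DecompShape X Y Z =
  NoBox X × NoBox Z ×
  Contains □₁ Y × Contains □₂ Y ×
  ¬ Contains T Y × ¬ Contains F Y ×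
  Contains T Z × Contains F Z

IsCCD : Tree → Tree → Tree → Set
IsCCD X Y Z =
  (X ≡ Y [ □₁ ↦ Z , □₂ ↦ Z [ T ↦ leaf F ] ]) × DecompShape X Y Z

IsCDD : Tree → Tree → Tree → Set
IsCDD X Y Z =
  (X ≡ Y [ □₁ ↦ Z [ F ↦ leaf T ] , □₂ ↦ Z ]) × DecompShape X Y Z

IsCD : Tree → Tree → Tree → Set
IsCD X Y Z = IsCCD X Y Z × (∀ Y' Z' → IsCCD X Y' Z' → ¬ (depth Z' < depth Z))

IsDD : Tree → Tree → Tree → Set
IsDD X Y Z = IsCDD X Y Z × (∀ Y' Z' → IsCDD X Y' Z' → ¬ (depth Z' < depth Z))

UniqueDecomp : (Tree → Tree → Tree → Set) → Tree → Tree → Tree → Set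
UniqueDecomp D X Y Z = D X Y Z × (∀ Y' Z' → D X Y' Z' → (Y' ≡ Y × Z' ≡ Z))

NoDecomp : (Tree → Tree → Tree → Set) → Tree → Set
NoDecomp D X = ∀ Y Z → ¬ D X Y Z

module Submission where

-- Both halves of the theorem are one statement about an operator o ∈ {∧●, ∨●}
-- with neutral value n and absorbing value z (n = T, z = F for ∧●; dually for ∨●):
-- fe(P o Q) = fe P[n ↦ W, z ↦ W[n ↦ z]] with W = fe Q, and an o-decomposition
-- (Y , Z) writes a tree as Y[box n ↦ Z, box z ↦ Z[n ↦ z]].
--
-- The engine is a comparison of two substitutions whose pieces all have fixed
-- depths d and e: if ρ[A] = σ[B] and e ≤ d then B refines A, every ρ-piece being
-- a σ-image of a part of B ('refine'); for e = d the two trees have the same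
-- skeleton ('same-depth').  With it we show that the trees of *-terms are
-- bicoloured and "untiled" (not several copies of one tree hung below a proper
-- skeleton), that a dual-operator decomposition of a combination cannot use the
-- box of the neutral value ('crossed'), and hence that the right operand of a
-- combination has no decomposition with a shallower component
-- ('operand-indecomposable').

open import Defs
open import Data.Product using (_×_; _,_; Σ; proj₁; proj₂; swap)
open import Data.Empty using (⊥; ⊥-elim)
open import Data.Unit using (⊤; tt)
open import Data.Bool using (true; false; if_then_else_)
open import Data.Nat using (ℕ; suc; _≤_; _<_; _+_; _⊔_; _<?_)
open import Data.Nat.Properties
  using (≤-refl; ≤-antisym; <⇒≤; ≮⇒≥; <-irrefl; m+n≮n; +-identityʳ; +-distribʳ-⊔)
open import Relation.Nullary using (¬_; yes; no)
open import Relation.Binary.PropositionalEquality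
open ≡-Reasoning

_⊆ˡ_ : Tree → Tree → Set
A ⊆ˡ B = ∀ {l} → Contains l A → Contains l B

some-leaf : ∀ X → Σ Leaf λ l → Contains l X
some-leaf (leaf l) = l , here
some-leaf (X ⊴ _ ⊵ _) with some-leaf X
... | l , l∈X = l , left l∈X

leaf-∈ : ∀ {l k} → Contains l (leaf k) → l ≡ k
leaf-∈ here = refl

⊴⊵-injective : ∀ {X a Y X' a' Y'} → (X ⊴ a ⊵ Y) ≡ (X' ⊴ a' ⊵ Y') → X ≡ X' × a ≡ a' × Y ≡ Y'
⊴⊵-injective refl = refl , refl , refl

∈-replace⁺ : ∀ σ {l k} Y → Contains k Y → Contains l (σ k) → Contains l (replace σ Y)
∈-replace⁺ σ (leaf _) here c = c
∈-replace⁺ σ (X ⊴ _ ⊵ _) (left k∈X) c = left (∈-replace⁺ σ X k∈X c)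
∈-replace⁺ σ (_ ⊴ _ ⊵ Y) (right k∈Y) c = right (∈-replace⁺ σ Y k∈Y c)

∈-replace⁻ : ∀ σ {l} Y → Contains l (replace σ Y) → Σ Leaf λ k → Contains k Y × Contains l (σ k)
∈-replace⁻ σ (leaf k) c = k , here , c
∈-replace⁻ σ (X ⊴ _ ⊵ Y) (left c) with ∈-replace⁻ σ X c
... | k , k∈X , d = k , left k∈X , d
∈-replace⁻ σ (X ⊴ _ ⊵ Y) (right c) with ∈-replace⁻ σ Y c
... | k , k∈Y , d = k , right k∈Y , d

replace-∘ : ∀ ρ τ Y → replace ρ (replace τ Y) ≡ replace (λ l → replace ρ (τ l)) Y
replace-∘ ρ τ (leaf l) = refl
replace-∘ ρ τ (X ⊴ a ⊵ Y) = cong₂ (λ u v → u ⊴ a ⊵ v) (replace-∘ ρ τ X) (replace-∘ ρ τ Y)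

replace-cong : ∀ {σ σ'} Y → (∀ {l} → Contains l Y → σ l ≡ σ' l) → replace σ Y ≡ replace σ' Y
replace-cong (leaf l) h = h here
replace-cong (X ⊴ a ⊵ Y) h =
  cong₂ (λ u v → u ⊴ a ⊵ v) (replace-cong X (λ c → h (left c))) (replace-cong Y (λ c → h (right c)))

replace-leaf : ∀ Y → replace leaf Y ≡ Y
replace-leaf (leaf l) = refl
replace-leaf (X ⊴ a ⊵ Y) = cong₂ (λ u v → u ⊴ a ⊵ v) (replace-leaf X) (replace-leaf Y)

-- Tilings: copies of one tree A hung below the skeleton Y

tiling : Tree → Tree → Tree
tiling A Y = replace (λ _ → A) Y

∈-tiling⁻ : ∀ A Y → tiling A Y ⊆ˡ A
∈-tiling⁻ A Y c = proj₂ (proj₂ (∈-replace⁻ (λ _ → A) Y c))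

∈-tiling⁺ : ∀ A Y → A ⊆ˡ tiling A Y
∈-tiling⁺ A Y c = ∈-replace⁺ (λ _ → A) Y (proj₂ (some-leaf Y)) c

IsNode : Tree → Set
IsNode (leaf _) = ⊥
IsNode (_ ⊴ _ ⊵ _) = ⊤

Untiled : Tree → Set
Untiled X = ∀ {A Y} → IsNode Y → X ≢ tiling A Y

untiled-tiling : ∀ {X A} Y → Untiled X → X ≡ tiling A Y → X ≡ A
untiled-tiling (leaf _) ut eq = eq
untiled-tiling {A = A} Y@(_ ⊴ _ ⊵ _) ut eq = ⊥-elim (ut {A} {Y} tt eq)

-- Substitutions with pieces of uniform depth

Uniform : (Leaf → Tree) → ℕ → Tree → Set
Uniform σ e B = ∀ {b} → Contains b B → depth (σ b) ≡ e

depth-replace : ∀ σ {e} B → Uniform σ e B → depth (replace σ B) ≡ depth B + e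
depth-replace σ (leaf b) u = u here
depth-replace σ {e} (B₁ ⊴ _ ⊵ B₂) u = cong suc (begin
  depth (replace σ B₁) ⊔ depth (replace σ B₂)
    ≡⟨ cong₂ _⊔_ (depth-replace σ B₁ (λ c → u (left c))) (depth-replace σ B₂ (λ c → u (right c))) ⟩
  (depth B₁ + e) ⊔ (depth B₂ + e)
    ≡⟨ sym (+-distribʳ-⊔ e (depth B₁) (depth B₂)) ⟩
  (depth B₁ ⊔ depth B₂) + e ∎)

node-too-deep : ∀ σ {d e} B → IsNode B → Uniform σ d B → depth (replace σ B) ≡ e → e ≤ d → ⊥
node-too-deep σ {d} (B₁ ⊴ _ ⊵ B₂) _ u eq e≤d =
  m+n≮n (depth B₁ ⊔ depth B₂) d (subst (_≤ d) (trans (sym eq) (depth-replace σ _ u)) e≤d)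

data Refines (ρ σ : Leaf → Tree) : Tree → Tree → Set where
  tile : ∀ {l B} → ρ l ≡ replace σ B → Refines ρ σ (leaf l) B
  fork : ∀ {A₁ A₂ B₁ B₂ a} → Refines ρ σ A₁ B₁ → Refines ρ σ A₂ B₂ →
         Refines ρ σ (A₁ ⊴ a ⊵ A₂) (B₁ ⊴ a ⊵ B₂)

refine : ∀ ρ σ {d e} A B → Uniform ρ d A → Uniform σ e B → e ≤ d →
         replace ρ A ≡ replace σ B → Refines ρ σ A B
refine ρ σ (leaf l) B uA uB e≤d eq = tile eq
refine ρ σ A@(_ ⊴ _ ⊵ _) (leaf b) uA uB e≤d eq =
  ⊥-elim (node-too-deep ρ A tt uA (trans (cong depth eq) (uB here)) e≤d)
refine ρ σ (A₁ ⊴ a ⊵ A₂) (B₁ ⊴ b ⊵ B₂) uA uB e≤d eq with ⊴⊵-injective eq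
... | eq₁ , refl , eq₂ =
  fork (refine ρ σ A₁ B₁ (λ c → uA (left c)) (λ c → uB (left c)) e≤d eq₁)
       (refine ρ σ A₂ B₂ (λ c → uA (right c)) (λ c → uB (right c)) e≤d eq₂)

tile-at : ∀ {ρ σ A B l} → Refines ρ σ A B → Contains l A →
          Σ Tree λ B' → B' ⊆ˡ B × ρ l ≡ replace σ B'
tile-at (tile eq) here = _ , (λ c → c) , eq
tile-at (fork r₁ r₂) (left c) with tile-at r₁ c
... | B' , B'⊆ , eq = B' , (λ d → left (B'⊆ d)) , eq
tile-at (fork r₁ r₂) (right c) with tile-at r₂ c
... | B' , B'⊆ , eq = B' , (λ d → right (B'⊆ d)) , eq

tile-of : ∀ {ρ σ A B b} → Refines ρ σ A B → Contains b B →
          Σ Leaf λ l → Contains l A × Σ Tree λ B' → B' ⊆ˡ B × Contains b B' × ρ l ≡ replace σ B'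
tile-of (tile eq) b∈B = _ , here , _ , (λ c → c) , b∈B , eq
tile-of (fork r₁ r₂) (left c) with tile-of r₁ c
... | l , l∈A , B' , B'⊆ , b∈B' , eq = l , left l∈A , B' , (λ d → left (B'⊆ d)) , b∈B' , eq
tile-of (fork r₁ r₂) (right c) with tile-of r₂ c
... | l , l∈A , B' , B'⊆ , b∈B' , eq = l , right l∈A , B' , (λ d → right (B'⊆ d)) , b∈B' , eq

inherit : ∀ {ρ σ A B c} → Refines ρ σ A B → (∀ {b} → Contains b B → Contains c (σ b)) →
          ∀ {l} → Contains l A → Contains c (ρ l)
inherit {ρ} {σ} {c = c} r every l∈A with tile-at r l∈A
... | B' , B'⊆ , eq with some-leaf B'
... | b , b∈B' = subst (Contains c) (sym eq) (∈-replace⁺ σ B' b∈B' (every (B'⊆ b∈B')))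

data Pointwise (R : Leaf → Leaf → Set) : Tree → Tree → Set where
  leaves : ∀ {l b} → R l b → Pointwise R (leaf l) (leaf b)
  fork   : ∀ {A₁ A₂ B₁ B₂ a} → Pointwise R A₁ B₁ → Pointwise R A₂ B₂ →
           Pointwise R (A₁ ⊴ a ⊵ A₂) (B₁ ⊴ a ⊵ B₂)

-- With pieces of equal depth, every tile is a single leaf.
same-depth : ∀ ρ σ {d} A B → Uniform ρ d A → Uniform σ d B → replace ρ A ≡ replace σ B →
             Pointwise (λ l b → ρ l ≡ σ b) A B
same-depth ρ σ A B uA uB eq = flatten (refine ρ σ A B uA uB ≤-refl eq) uA uB
  where
  flatten : ∀ {A B d} → Refines ρ σ A B → Uniform ρ d A → Uniform σ d B →
            Pointwise (λ l b → ρ l ≡ σ b) A B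
  flatten (tile {B = leaf _} eq) uA uB = leaves eq
  flatten (tile {B = B@(_ ⊴ _ ⊵ _)} eq) uA uB =
    ⊥-elim (node-too-deep σ B tt uB (trans (sym (cong depth eq)) (uA here)) ≤-refl)
  flatten (fork r₁ r₂) uA uB =
    fork (flatten r₁ (λ c → uA (left c)) (λ c → uB (left c)))
         (flatten r₂ (λ c → uA (right c)) (λ c → uB (right c)))

partner : ∀ {R A B b} → Pointwise R A B → Contains b B → Σ Leaf λ l → Contains l A × R l b
partner (leaves r) here = _ , here , r
partner (fork p₁ p₂) (left c) with partner p₁ c
... | l , l∈A , r = l , left l∈A , r
partner (fork p₁ p₂) (right c) with partner p₂ c
... | l , l∈A , r = l , right l∈A , r

relabel : ∀ {R A B} τ → Pointwise R A B →
          (∀ {l b} → Contains l A → Contains b B → R l b → τ l ≡ leaf b) → replace τ A ≡ B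
relabel τ (leaves r) h = h here here r
relabel τ (fork p₁ p₂) h =
  cong₂ (λ u v → u ⊴ _ ⊵ v) (relabel τ p₁ (λ cl cb → h (left cl) (left cb)))
                            (relabel τ p₂ (λ cl cb → h (right cl) (right cb)))

data Colour : Leaf → Set where
  T-colour : Colour T
  F-colour : Colour F

data Box : Leaf → Set where
  □₁-box : Box □₁
  □₂-box : Box □₂

NoTF : Tree → Set
NoTF Y = ¬ Contains T Y × ¬ Contains F Y

Bicolour : Tree → Set
Bicolour X = Contains T X × Contains F X

colour : ∀ {X l} → NoBox X → Contains l X → Colour l
colour {l = T} _ _ = T-colour
colour {l = F} _ _ = F-colour
colour {l = □₁} (no□₁ , _) c = ⊥-elim (no□₁ c)
colour {l = □₂} (_ , no□₂) c = ⊥-elim (no□₂ c)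

isBox : ∀ {Y b} → NoTF Y → Contains b Y → Box b
isBox {b = T} (noT , _) c = ⊥-elim (noT c)
isBox {b = F} (_ , noF) c = ⊥-elim (noF c)
isBox {b = □₁} _ _ = □₁-box
isBox {b = □₂} _ _ = □₂-box

noBox-⊆ : ∀ {A B} → A ⊆ˡ B → NoBox B → NoBox A
noBox-⊆ A⊆B (no□₁ , no□₂) = (λ c → no□₁ (A⊆B c)) , (λ c → no□₂ (A⊆B c))

noTF-⊆ : ∀ {A B} → A ⊆ˡ B → NoTF B → NoTF A
noTF-⊆ A⊆B (noT , noF) = (λ c → noT (A⊆B c)) , (λ c → noF (A⊆B c))

bicolour-⊆ : ∀ {A B} → A ⊆ˡ B → Bicolour A → Bicolour B
bicolour-⊆ A⊆B (cT , cF) = A⊆B cT , A⊆B cF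

leaf-noBox : ∀ {l} → Colour l → NoBox (leaf l)
leaf-noBox T-colour = (λ ()) , (λ ())
leaf-noBox F-colour = (λ ()) , (λ ())

replace-noBox : ∀ σ X → NoBox X → (∀ {l} → Colour l → NoBox (σ l)) → NoBox (replace σ X)
replace-noBox σ X nb nbσ = absent proj₁ , absent proj₂
  where
  absent : ∀ {b} → (∀ {Z} → NoBox Z → ¬ Contains b Z) → ¬ Contains b (replace σ X)
  absent which c with ∈-replace⁻ σ X c
  ... | k , k∈X , b∈σk = which (nbσ (colour nb k∈X)) b∈σk

replace-injective : ∀ ρ {d X X'} → Uniform ρ d X → Uniform ρ d X' → NoBox X → NoBox X' →
                    ρ T ≢ ρ F → replace ρ X ≡ replace ρ X' → X ≡ X'
replace-injective ρ {X = X} {X'} uX uX' nb nb' sep eq = begin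
  X              ≡⟨ sym (replace-leaf X) ⟩
  replace leaf X ≡⟨ relabel leaf (same-depth ρ ρ X X' uX uX' eq) same-colour ⟩
  X'             ∎
  where
  same-colour : ∀ {l b} → Contains l X → Contains b X' → ρ l ≡ ρ b → leaf l ≡ leaf b
  same-colour l∈X b∈X' e with colour nb l∈X | colour nb' b∈X'
  ... | T-colour | T-colour = refl
  ... | T-colour | F-colour = ⊥-elim (sep e)
  ... | F-colour | T-colour = ⊥-elim (sep (sym e))
  ... | F-colour | F-colour = refl

eqL-refl : ∀ l → eqL l l ≡ true
eqL-refl T = refl
eqL-refl F = refl
eqL-refl □₁ = refl
eqL-refl □₂ = refl

rename-removes : ∀ {k k'} X → k ≢ k' → ¬ Contains k (X [ k ↦ leaf k' ])
rename-removes {k} {k'} X k≢k' c with ∈-replace⁻ _ X c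
... | l , _ , d with eqL l k in e
... | true = k≢k' (leaf-∈ d)
... | false with leaf-∈ d
... | refl with trans (sym (eqL-refl k)) e
... | ()

depth-rename : ∀ X k k' → depth (X [ k ↦ leaf k' ]) ≡ depth X
depth-rename X k k' = trans (depth-replace _ X piece-depth) (+-identityʳ (depth X))
  where
  piece-depth : ∀ {l} → Contains l X → depth (if eqL l k then leaf k' else leaf l) ≡ 0
  piece-depth {l} _ with eqL l k
  ... | true = refl
  ... | false = refl

rename-noBox : ∀ {k k' X} → Colour k' → NoBox X → NoBox (X [ k ↦ leaf k' ])
rename-noBox {k} {k'} {X} ck' nb = replace-noBox _ X nb piece
  where
  piece : ∀ {l} → Colour l → NoBox (if eqL l k then leaf k' else leaf l)
  piece {l} cl with eqL l k
  ... | true = leaf-noBox ck'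
  ... | false = leaf-noBox cl

Monochrome : Leaf → Tree → Set
Monochrome k X = ∀ {l} → Contains l X → l ≡ k

mono-replace : ∀ {σ k k'} X → Monochrome k X → σ k ≡ leaf k' → Monochrome k' (replace σ X)
mono-replace {σ} X m eq c with ∈-replace⁻ σ X c
... | l , l∈X , d with m l∈X
... | refl = leaf-∈ (subst (Contains _) eq d)

mono-contains : ∀ {k X} → Monochrome k X → Contains k X
mono-contains {X = X} m with some-leaf X
... | l , l∈X with m l∈X
... | refl = l∈X

mono-not-bicolour : ∀ {k X} → Monochrome k X → ¬ Bicolour X
mono-not-bicolour m (cT , cF) with trans (m cT) (sym (m cF))
... | ()

data Op : Set where
  conj disj : Op

neutral absorbing : Op → Leaf
neutral conj = T
neutral disj = F
absorbing conj = F
absorbing disj = T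

dual : Op → Op
dual conj = disj
dual disj = conj

Operand : Op → FEL → Set
Operand conj = DTerm
Operand disj = CTerm

collapse : Op → Tree → Tree
collapse o W = W [ neutral o ↦ leaf (absorbing o) ]

-- Definitionally fe (P ∧● Q) = fe P [ combine conj (fe Q) ], and likewise for ∨●.
combine : Op → Tree → Leaf → Tree
combine conj W l = if eqL l T then W else (if eqL l F then collapse conj W else leaf l)
combine disj W l = if eqL l T then collapse disj W else (if eqL l F then W else leaf l)

-- Y [ plug o Z ] is the tree decomposed as (Y , Z) with respect to o.
plug : Op → Tree → Leaf → Tree
plug conj Z l = if eqL l □₁ then Z else (if eqL l □₂ then collapse conj Z else leaf l)
plug disj Z l = if eqL l □₁ then collapse disj Z else (if eqL l □₂ then Z else leaf l)

-- The paper's candidate decompositions and decompositions, uniformly in o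
-- (definitionally IsCCD, IsCD for ∧● and IsCDD, IsDD for ∨●).
Candidate : Op → Tree → Tree → Tree → Set
Candidate o X Y Z = (X ≡ replace (plug o Z) Y) × DecompShape X Y Z

Decomposition : Op → Tree → Tree → Tree → Set
Decomposition o X Y Z = Candidate o X Y Z × (∀ Y' Z' → Candidate o X Y' Z' → ¬ (depth Z' < depth Z))

-- The candidate skeleton fe P [ T ↦ □₁ , F ↦ □₂ ].
boxing : Leaf → Tree
boxing l = if eqL l T then leaf □₁ else (if eqL l F then leaf □₂ else leaf l)

box : Leaf → Leaf
box T = □₁
box F = □₂
box l = l

data Role (o : Op) : Leaf → Set where
  neutral-role   : Role o (neutral o)
  absorbing-role : Role o (absorbing o)

role : ∀ o {l} → Colour l → Role o l
role conj T-colour = neutral-role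
role conj F-colour = absorbing-role
role disj T-colour = absorbing-role
role disj F-colour = neutral-role

data Slot (o : Op) : Leaf → Set where
  neutral-slot   : Slot o (box (neutral o))
  absorbing-slot : Slot o (box (absorbing o))

slot : ∀ o {b} → Box b → Slot o b
slot conj □₁-box = neutral-slot
slot conj □₂-box = absorbing-slot
slot disj □₁-box = absorbing-slot
slot disj □₂-box = neutral-slot

neutral∈ : ∀ o {X} → Bicolour X → Contains (neutral o) X
neutral∈ conj = proj₁
neutral∈ disj = proj₂

absorbing∈ : ∀ o {X} → Bicolour X → Contains (absorbing o) X
absorbing∈ conj = proj₂
absorbing∈ disj = proj₁

bicolour : ∀ o {X} → Contains (neutral o) X → Contains (absorbing o) X → Bicolour X
bicolour conj cn ca = cn , ca
bicolour disj cn ca = ca , cn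

collapse-lacks-neutral : ∀ o W → ¬ Contains (neutral o) (collapse o W)
collapse-lacks-neutral conj W = rename-removes W (λ ())
collapse-lacks-neutral disj W = rename-removes W (λ ())

collapse-keeps-absorbing : ∀ o {W} → Contains (absorbing o) W → Contains (absorbing o) (collapse o W)
collapse-keeps-absorbing conj {W} c = ∈-replace⁺ _ W c here
collapse-keeps-absorbing disj {W} c = ∈-replace⁺ _ W c here

W≢collapse : ∀ o {W} → Contains (neutral o) W → W ≢ collapse o W
W≢collapse o {W} c eq = collapse-lacks-neutral o W (subst (Contains (neutral o)) eq c)

combine-neutral : ∀ o W → combine o W (neutral o) ≡ W
combine-neutral conj W = refl
combine-neutral disj W = refl

combine-absorbing : ∀ o W → combine o W (absorbing o) ≡ collapse o W
combine-absorbing conj W = refl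
combine-absorbing disj W = refl

plug-neutral : ∀ o Z → plug o Z (box (neutral o)) ≡ Z
plug-neutral conj Z = refl
plug-neutral disj Z = refl

plug-absorbing : ∀ o Z → plug o Z (box (absorbing o)) ≡ collapse o Z
plug-absorbing conj Z = refl
plug-absorbing disj Z = refl

plug-dual-absorbing : ∀ o Z → plug (dual o) Z (box (absorbing o)) ≡ Z
plug-dual-absorbing conj Z = refl
plug-dual-absorbing disj Z = refl

plug-dual-lacks : ∀ o Z → ¬ Contains (absorbing o) (plug (dual o) Z (box (neutral o)))
plug-dual-lacks conj Z = collapse-lacks-neutral disj Z
plug-dual-lacks disj Z = collapse-lacks-neutral conj Z

plug-dual-neutral : ∀ o {Z b} → Bicolour Z → Box b → Contains (neutral o) (plug (dual o) Z b)
plug-dual-neutral conj (cT , cF) □₁-box = collapse-keeps-absorbing disj cT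
plug-dual-neutral conj (cT , cF) □₂-box = cT
plug-dual-neutral disj (cT , cF) □₁-box = cF
plug-dual-neutral disj (cT , cF) □₂-box = collapse-keeps-absorbing conj cF

combine-uniform : ∀ o W {X} → NoBox X → Uniform (combine o W) (depth W) X
combine-uniform o W nb c with role o (colour nb c)
... | neutral-role = cong depth (combine-neutral o W)
... | absorbing-role = trans (cong depth (combine-absorbing o W)) (depth-rename W _ _)

plug-uniform : ∀ o Z {Y} → NoTF Y → Uniform (plug o Z) (depth Z) Y
plug-uniform o Z nt c with slot o (isBox nt c)
... | neutral-slot = cong depth (plug-neutral o Z)
... | absorbing-slot = trans (cong depth (plug-absorbing o Z)) (depth-rename Z _ _)

combine-separates : ∀ o {W} → Contains (neutral o) W → combine o W T ≢ combine o W F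
combine-separates conj c = W≢collapse conj c
combine-separates disj c eq = W≢collapse disj c (sym eq)

combine-absorbing-everywhere : ∀ o {W l} → Contains (absorbing o) W → Colour l →
                               Contains (absorbing o) (combine o W l)
combine-absorbing-everywhere conj c T-colour = c
combine-absorbing-everywhere conj c F-colour = collapse-keeps-absorbing conj c
combine-absorbing-everywhere disj c T-colour = collapse-keeps-absorbing disj c
combine-absorbing-everywhere disj c F-colour = c

combine-noBox : ∀ o {W l} → NoBox W → Colour l → NoBox (combine o W l)
combine-noBox conj nb T-colour = nb
combine-noBox conj nb F-colour = rename-noBox F-colour nb
combine-noBox disj nb T-colour = rename-noBox T-colour nb
combine-noBox disj nb F-colour = nb

combine-bicolour : ∀ o {X W} → Bicolour X → Bicolour W → Bicolour (replace (combine o W) X)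
combine-bicolour o {X} {W} bX bW = bicolour o
  (∈-replace⁺ _ X (neutral∈ o bX) (subst (Contains (neutral o)) (sym (combine-neutral o W)) (neutral∈ o bW)))
  (∈-replace⁺ _ X (absorbing∈ o bX) (subst (Contains (absorbing o)) (sym (combine-absorbing o W))
                                          (collapse-keeps-absorbing o (absorbing∈ o bW))))

combine-via-boxes : ∀ o W {l} → Colour l → combine o W l ≡ replace (plug o W) (boxing l)
combine-via-boxes conj W T-colour = refl
combine-via-boxes conj W F-colour = refl
combine-via-boxes disj W T-colour = refl
combine-via-boxes disj W F-colour = refl

piece-box : ∀ o {W l b} → Contains (neutral o) W → Colour l → Box b →
            combine o W l ≡ plug o W b → boxing l ≡ leaf b
piece-box conj c T-colour □₁-box e = refl
piece-box conj c T-colour □₂-box e = ⊥-elim (W≢collapse conj c e)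
piece-box conj c F-colour □₁-box e = ⊥-elim (W≢collapse conj c (sym e))
piece-box conj c F-colour □₂-box e = refl
piece-box disj c T-colour □₁-box e = refl
piece-box disj c T-colour □₂-box e = ⊥-elim (W≢collapse disj c (sym e))
piece-box disj c F-colour □₁-box e = ⊥-elim (W≢collapse disj c e)
piece-box disj c F-colour □₂-box e = refl

boxed-noTF : ∀ {A} → NoBox A → NoTF (replace boxing A)
boxed-noTF {A} nb = no-colour T-colour , no-colour F-colour
  where
  boxed-piece : ∀ {k l} → Colour k → Colour l → ¬ Contains k (boxing l)
  boxed-piece T-colour T-colour ()
  boxed-piece T-colour F-colour ()
  boxed-piece F-colour T-colour ()
  boxed-piece F-colour F-colour ()
  no-colour : ∀ {k} → Colour k → ¬ Contains k (replace boxing A)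
  no-colour ck c with ∈-replace⁻ boxing A c
  ... | l , l∈A , d = boxed-piece ck (colour nb l∈A) d

shape-noTF : ∀ {X Y Z} → DecompShape X Y Z → NoTF Y
shape-noTF (_ , _ , _ , _ , noT , noF , _) = noT , noF

shape-bicolour : ∀ {X Y Z} → DecompShape X Y Z → Bicolour Z
shape-bicolour (_ , _ , _ , _ , _ , _ , cT , cF) = cT , cF

shape-neutral-box : ∀ o {X Y Z} → DecompShape X Y Z → Contains (box (neutral o)) Y
shape-neutral-box conj (_ , _ , c₁ , _) = c₁
shape-neutral-box disj (_ , _ , _ , c₂ , _) = c₂

-- Combinations versus decompositions

-- A combination X[combine o W] decomposed for the dual operator cannot use the
-- box of neutral o: a shallower component would force the collapse of W to
-- contain neutral o, one at least as deep would force the collapse of Z to contain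
-- absorbing o.
crossed : ∀ o {X W Y Z} → NoBox X → Bicolour X → Bicolour W → NoTF Y → Bicolour Z →
          replace (combine o W) X ≡ replace (plug (dual o) Z) Y → ¬ Contains (box (neutral o)) Y
crossed o {X} {W} {Y} {Z} nbX bX bW ntY bZ eq n∈Y with depth Z <? depth W
... | yes Z<W =
  collapse-lacks-neutral o W (subst (Contains (neutral o)) (combine-absorbing o W)
    (inherit (refine (combine o W) (plug (dual o) Z) X Y
                     (combine-uniform o W nbX) (plug-uniform (dual o) Z ntY) (<⇒≤ Z<W) eq)
             (λ b∈Y → plug-dual-neutral o bZ (isBox ntY b∈Y)) (absorbing∈ o bX)))
... | no Z≮W =
  plug-dual-lacks o Z
    (inherit (refine (plug (dual o) Z) (combine o W) Y X
                     (plug-uniform (dual o) Z ntY) (combine-uniform o W nbX) (≮⇒≥ Z≮W) (sym eq))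
             (λ l∈X → combine-absorbing-everywhere o (absorbing∈ o bW) (colour nbX l∈X)) n∈Y)

tiling-descends : ∀ ρ {d X A} Y → Uniform ρ d X → NoBox X → ρ T ≢ ρ F → d ≤ depth A →
                  replace ρ X ≡ tiling A Y → Σ Tree λ A' → X ≡ tiling A' Y
tiling-descends ρ {d} {X} {A} Y uX nbX sep d≤A eq
  with tile-at (refine (λ _ → A) ρ Y X (λ _ → refl) uX d≤A (sym eq)) (proj₂ (some-leaf Y))
... | A' , A'⊆X , A≡ = A' , replace-injective ρ uX (λ c → uX (tiled⊆X c)) nbX (noBox-⊆ tiled⊆X nbX) sep eq'
  where
  tiled⊆X : tiling A' Y ⊆ˡ X
  tiled⊆X c = A'⊆X (∈-tiling⁻ A' Y c)
  eq' : replace ρ X ≡ replace ρ (tiling A' Y)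
  eq' = begin
    replace ρ X              ≡⟨ eq ⟩
    tiling A Y               ≡⟨ cong (λ B → tiling B Y) A≡ ⟩
    tiling (replace ρ A') Y  ≡⟨ sym (replace-∘ ρ (λ _ → A') Y) ⟩
    replace ρ (tiling A' Y)  ∎

-- Combining an untiled bicoloured tree with a bicoloured tree keeps it untiled: a
-- tiling by a tree shallower than W would make every piece, including the collapse
-- of W, contain neutral o; a tiling by a deeper tree descends to X.
combine-untiled : ∀ o {X W} → NoBox X → Bicolour X → Untiled X → Bicolour W →
                  Untiled (replace (combine o W) X)
combine-untiled o {X} {W} nbX bX utX bW {A} {Y} isNode eq with depth A <? depth W
... | yes A<W =
  collapse-lacks-neutral o W (subst (Contains (neutral o)) (combine-absorbing o W)
    (inherit r (λ _ → A-has-neutral) (absorbing∈ o bX)))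
  where
  r : Refines (combine o W) (λ _ → A) X Y
  r = refine (combine o W) (λ _ → A) X Y (combine-uniform o W nbX) (λ _ → refl) (<⇒≤ A<W) eq
  -- The piece W is a tiling by A, so A carries the neutral value of W.
  A-has-neutral : Contains (neutral o) A
  A-has-neutral with tile-at r (neutral∈ o bX)
  ... | B' , _ , W≡ =
    ∈-tiling⁻ A B' (subst (Contains (neutral o)) (trans (sym (combine-neutral o W)) W≡) (neutral∈ o bW))
... | no A≮W with tiling-descends (combine o W) Y (combine-uniform o W nbX) nbX
                   (combine-separates o (neutral∈ o bW)) (≮⇒≥ A≮W) eq
... | A' , X≡ = utX {A'} {Y} isNode X≡

Regular : Tree → Set
Regular X = Bicolour X × Untiled X

combine-regular : ∀ o {X W} → NoBox X → Regular X → Bicolour W → Regular (replace (combine o W) X)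
combine-regular o nbX (bX , utX) bW = combine-bicolour o bX bW , combine-untiled o nbX bX utX bW

-- A combination of regular trees has no dual-operator decomposition whose
-- component is shallower than the whole tree: by 'crossed' it would be a tiling.
combination-indecomposable : ∀ o {X W Y Z} → NoBox X → Regular X → Bicolour W → NoTF Y → Bicolour Z →
  depth Z < depth (replace (combine o W) X) → replace (combine o W) X ≢ replace (plug (dual o) Z) Y
combination-indecomposable o {X} {W} {Y} {Z} nbX regX bW ntY bZ Z< eq =
  <-irrefl (cong depth (sym (untiled-tiling Y (proj₂ (combine-regular o nbX regX bW)) tiled))) Z<
  where
  -- Only the box of absorbing o occurs, and it carries Z itself.
  piece-is-Z : ∀ {b} → Contains b Y → plug (dual o) Z b ≡ Z
  piece-is-Z b∈Y with slot o (isBox ntY b∈Y)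
  ... | neutral-slot = ⊥-elim (crossed o nbX (proj₁ regX) bW ntY bZ eq b∈Y)
  ... | absorbing-slot = plug-dual-absorbing o Z
  tiled : replace (combine o W) X ≡ tiling Z Y
  tiled = trans eq (replace-cong Y piece-is-Z)

-- Literals

data Literal : Tree → Set where
  positive : ∀ {L a R} → Monochrome T L → Monochrome F R → Literal (L ⊴ a ⊵ R)
  negative : ∀ {L a R} → Monochrome F L → Monochrome T R → Literal (L ⊴ a ⊵ R)

-- T-terms evaluate to T everywhere, so literal trees have monochrome branches.
tterm-mono : ∀ {P} → TTerm P → Monochrome T (fe P)
tterm-mono tT here = refl
tterm-mono (tOr a {P} p) (left c) = mono-replace (fe P) (tterm-mono p) refl c
tterm-mono (tOr a p) (right c) = tterm-mono p c

literal-shape : ∀ {P} → LTerm P → Literal (fe P)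
literal-shape (lPos a {P} p) = positive (tterm-mono p) (mono-replace (fe P) (tterm-mono p) refl)
literal-shape (lNeg a {P} p) = negative (mono-replace (fe P) (tterm-mono p) refl) (tterm-mono p)

branches-mono : ∀ {L a R} → Literal (L ⊴ a ⊵ R) → ¬ Bicolour L × ¬ Bicolour R
branches-mono (positive mT mF) = mono-not-bicolour mT , mono-not-bicolour mF
branches-mono (negative mF mT) = mono-not-bicolour mF , mono-not-bicolour mT

branches-disjoint : ∀ {L a R k} → Literal (L ⊴ a ⊵ R) → Contains k L → Contains k R → ⊥
branches-disjoint (positive mT mF) k∈L k∈R with trans (sym (mT k∈L)) (mF k∈R)
... | ()
branches-disjoint (negative mF mT) k∈L k∈R with trans (sym (mF k∈L)) (mT k∈R)
... | ()

literal-bicolour : ∀ {X} → Literal X → Bicolour X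
literal-bicolour (positive mT mF) = left (mono-contains mT) , right (mono-contains mF)
literal-bicolour (negative mF mT) = right (mono-contains mT) , left (mono-contains mF)

-- A tiling over a proper skeleton would put the leaves of A in both branches.
literal-untiled : ∀ {X} → Literal X → Untiled X
literal-untiled {leaf _} ()
literal-untiled {_ ⊴ _ ⊵ _} lit {A} {leaf _} () eq
literal-untiled {_ ⊴ _ ⊵ _} lit {A} {Y₁ ⊴ _ ⊵ Y₂} _ eq with ⊴⊵-injective eq | some-leaf A
... | L≡ , _ , R≡ | k , k∈A =
  branches-disjoint lit (subst (Contains k) (sym L≡) (∈-tiling⁺ A Y₁ k∈A))
                        (subst (Contains k) (sym R≡) (∈-tiling⁺ A Y₂ k∈A))

literal-regular : ∀ {X} → Literal X → Regular X
literal-regular lit = literal-bicolour lit , literal-untiled lit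

-- A literal tree has no decomposition with a shallower bicoloured piece: the
-- piece would lie inside one monochrome branch.
literal-indecomposable : ∀ {X σ Y b} → Literal X → Contains b Y → Bicolour (σ b) →
                         depth (σ b) < depth X → X ≢ replace σ Y
literal-indecomposable lit here bσ lt eq = <-irrefl (sym (cong depth eq)) lt
literal-indecomposable {leaf _} () _ _ _ _
literal-indecomposable {_ ⊴ _ ⊵ _} {σ} {Y₁ ⊴ _ ⊵ _} lit (left b∈Y₁) bσ lt eq =
  proj₁ (branches-mono lit)
    (bicolour-⊆ (λ d → subst (Contains _) (sym (proj₁ (⊴⊵-injective eq))) (∈-replace⁺ σ Y₁ b∈Y₁ d)) bσ)
literal-indecomposable {_ ⊴ _ ⊵ _} {σ} {_ ⊴ _ ⊵ Y₂} lit (right b∈Y₂) bσ lt eq =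
  proj₂ (branches-mono lit)
    (bicolour-⊆ (λ d → subst (Contains _) (sym (proj₂ (proj₂ (⊴⊵-injective eq)))) (∈-replace⁺ σ Y₂ b∈Y₂ d)) bσ)

fe-box-free : ∀ P → NoBox (fe P)
fe-box-free (atom a) = (λ { (left ()) ; (right ()) }) , (λ { (left ()) ; (right ()) })
fe-box-free TT = leaf-noBox T-colour
fe-box-free FF = leaf-noBox F-colour
fe-box-free (¬ᶠ P) = replace-noBox _ (fe P) (fe-box-free P) negated
  where
  negated : ∀ {l} → Colour l → NoBox (if eqL l T then leaf F else (if eqL l F then leaf T else leaf l))
  negated T-colour = leaf-noBox F-colour
  negated F-colour = leaf-noBox T-colour
fe-box-free (P ∧● Q) = replace-noBox _ (fe P) (fe-box-free P) (combine-noBox conj (fe-box-free Q))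
fe-box-free (P ∨● Q) = replace-noBox _ (fe P) (fe-box-free P) (combine-noBox disj (fe-box-free Q))

star-regular : ∀ {P} → StarTerm P → Regular (fe P)
conj-regular : ∀ {P} → CTerm P → Regular (fe P)
disj-regular : ∀ {P} → DTerm P → Regular (fe P)
star-regular (sC c) = conj-regular c
star-regular (sD d) = disj-regular d
conj-regular (cL l) = literal-regular (literal-shape l)
conj-regular (cAnd {P} p d) = combine-regular conj (fe-box-free P) (star-regular p) (proj₁ (disj-regular d))
disj-regular (dL l) = literal-regular (literal-shape l)
disj-regular (dOr {P} p c) = combine-regular disj (fe-box-free P) (star-regular p) (proj₁ (conj-regular c))

operand-regular : ∀ o {Q} → Operand o Q → Regular (fe Q)
operand-regular conj = disj-regular
operand-regular disj = conj-regular

operand-indecomposable : ∀ o {Q Y Z} → Operand o Q → NoTF Y → Contains (box (neutral o)) Y →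
                         Bicolour Z → depth Z < depth (fe Q) → fe Q ≢ replace (plug o Z) Y
operand-indecomposable conj (dL l) ntY c bZ lt = literal-indecomposable (literal-shape l) c bZ lt
operand-indecomposable conj (dOr {P} p q) ntY c bZ lt =
  combination-indecomposable disj (fe-box-free P) (star-regular p) (proj₁ (conj-regular q)) ntY bZ lt
operand-indecomposable disj (cL l) ntY c bZ lt = literal-indecomposable (literal-shape l) c bZ lt
operand-indecomposable disj (cAnd {P} p q) ntY c bZ lt =
  combination-indecomposable conj (fe-box-free P) (star-regular p) (proj₁ (disj-regular q)) ntY bZ lt

module Combination (o : Op) {P Q : FEL} (p : StarTerm P) (q : Operand o Q) where

  W X Y₀ : Tree
  W = fe Q
  X = replace (combine o W) (fe P)
  Y₀ = replace boxing (fe P)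

  nbP : NoBox (fe P)
  nbP = fe-box-free P

  bP : Bicolour (fe P)
  bP = proj₁ (star-regular p)

  bW : Bicolour W
  bW = proj₁ (operand-regular o q)

  uP : Uniform (combine o W) (depth W) (fe P)
  uP = combine-uniform o W nbP

  canonical : Candidate o X Y₀ W
  canonical = X≡ , nbX , fe-box-free Q , ∈-replace⁺ boxing (fe P) (proj₁ bP) here ,
              ∈-replace⁺ boxing (fe P) (proj₂ bP) here , proj₁ ntY₀ , proj₂ ntY₀ , proj₁ bW , proj₂ bW
    where
    ntY₀ : NoTF Y₀
    ntY₀ = boxed-noTF nbP
    X≡ : X ≡ replace (plug o W) Y₀
    X≡ = begin
      replace (combine o W) (fe P)
        ≡⟨ replace-cong (fe P) (λ c → combine-via-boxes o W (colour nbP c)) ⟩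
      replace (λ l → replace (plug o W) (boxing l)) (fe P)
        ≡⟨ sym (replace-∘ (plug o W) boxing (fe P)) ⟩
      replace (plug o W) Y₀ ∎
    nbX : NoBox X
    nbX = replace-noBox _ (fe P) nbP (combine-noBox o (fe-box-free Q))

  -- A shallower candidate would place the box of neutral o inside a piece of
  -- the combination: inside W, contradicting indecomposability of the operand,
  -- or inside the collapse of W, which lacks neutral o.
  shallower-absurd : ∀ Y' Z' → Candidate o X Y' Z' → ¬ (depth Z' < depth W)
  shallower-absurd Y' Z' (eq , shape) Z'<W
    with tile-of (refine (combine o W) (plug o Z') (fe P) Y' uP (plug-uniform o Z' (shape-noTF shape))
                         (<⇒≤ Z'<W) eq)
                 (shape-neutral-box o shape)
  ... | l , l∈P , B' , B'⊆Y' , n∈B' , tile≡ with role o (colour nbP l∈P)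
  ... | neutral-role =
    operand-indecomposable o q (noTF-⊆ B'⊆Y' (shape-noTF shape)) n∈B' (shape-bicolour shape) Z'<W
      (trans (sym (combine-neutral o W)) tile≡)
  ... | absorbing-role =
    collapse-lacks-neutral o W (subst (Contains (neutral o)) (trans (sym tile≡) (combine-absorbing o W))
      (∈-replace⁺ (plug o Z') B' n∈B'
        (subst (Contains (neutral o)) (sym (plug-neutral o Z')) (neutral∈ o (shape-bicolour shape)))))

  -- A decomposition has a component as deep as W, hence the same skeleton as
  -- the canonical one; its neutral box must carry W, and then every box is forced.
  minimal-is-canonical : ∀ Y' Z' → Decomposition o X Y' Z' → Y' ≡ Y₀ × Z' ≡ W
  minimal-is-canonical Y' Z' ((eq , shape) , minimal) = Y'≡ , Z'≡
    where
    ntY : NoTF Y'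
    ntY = shape-noTF shape
    Z'≍W : depth Z' ≡ depth W
    Z'≍W = ≤-antisym (≮⇒≥ (minimal Y₀ W canonical)) (≮⇒≥ (shallower-absurd Y' Z' (eq , shape)))
    matched : Pointwise (λ l b → combine o W l ≡ plug o Z' b) (fe P) Y'
    matched = same-depth (combine o W) (plug o Z') (fe P) Y' uP
                (λ c → trans (plug-uniform o Z' ntY c) Z'≍W) eq
    Z'≡ : Z' ≡ W
    Z'≡ with partner matched (shape-neutral-box o shape)
    ... | l , l∈P , e with role o (colour nbP l∈P)
    ... | neutral-role = sym (trans (sym (combine-neutral o W)) (trans e (plug-neutral o Z')))
    ... | absorbing-role = ⊥-elim (collapse-lacks-neutral o W
          (subst (Contains (neutral o)) (sym (trans (sym (combine-absorbing o W)) (trans e (plug-neutral o Z'))))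
                 (neutral∈ o (shape-bicolour shape))))
    Y'≡ : Y' ≡ Y₀
    Y'≡ = sym (relabel boxing matched (λ l∈P b∈Y' e →
            piece-box o (neutral∈ o bW) (colour nbP l∈P) (isBox ntY b∈Y')
              (subst (λ Z → combine o W _ ≡ plug o Z _) Z'≡ e)))

  -- By 'crossed', no candidate of the dual kind can contain both boxes.
  no-dual-decomposition : NoDecomp (Decomposition (dual o)) X
  no-dual-decomposition Y' Z' ((eq , shape) , _) =
    crossed o nbP bP bW (shape-noTF shape) (shape-bicolour shape) eq (shape-neutral-box o shape)

  theorem : UniqueDecomp (Decomposition o) X Y₀ W × NoDecomp (Decomposition (dual o)) X
  theorem = ((canonical , shallower-absurd) , minimal-is-canonical) , no-dual-decomposition

mainTheorem9 :
    (∀ P Q → StarTerm P → DTerm Q →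
      UniqueDecomp IsCD (fe (P ∧● Q)) (fe P [ T ↦ leaf □₁ , F ↦ leaf □₂ ]) (fe Q)
      × NoDecomp IsDD (fe (P ∧● Q)))
    ×
    (∀ P Q → StarTerm P → CTerm Q →
      NoDecomp IsCD (fe (P ∨● Q))
      × UniqueDecomp IsDD (fe (P ∨● Q)) (fe P [ T ↦ leaf □₁ , F ↦ leaf □₂ ]) (fe Q))
mainTheorem9 =
  (λ P Q p q → Combination.theorem conj p q) ,
  (λ P Q p q → swap (Combination.theorem disj p q))
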